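{- Let $\mathcal F$ be a finite set of (0,1)-matrices and let $\ell\ge1$ be given. Then there exists a constant $d$ so that $${\rm forb}_k\big(m,3,(\mathcal{T}_{\ell}(3)\setminus \mathcal{T}_{\ell}(2))\cup\{T_{\ell}(0,2,1)\}\cup \mathcal F\big)=O\Big(\sum_{j=k-d}^{k}{\rm forbmax}_j(m,\mathcal F)\Big).$$
   Context: An $r$-matrix is a matrix with entries in $\{0,1,\ldots,r-1\}$ (a (0,1)-matrix is a 2-matrix). A matrix is simple if it has no repeated columns. For matrices $G,A$ write $G\prec A$ if some submatrix of $A$ is a row and column permutation of $G$. The column sum of a column of a 3-matrix is its number of 1's. For a finite family $\mathcal G$, ${\rm forb}_k(m,3,\mathcal G)$ is the maximum number of columns of an $m$-rowed simple 3-matrix $A$ all of whose columns have exactly $k$ 1's and with $G\not\prec A$ for all $G\in\mathcal G$; ${\rm forb}_k(m,\mathcal G)$ is the same for (0,1)-matrices, and ${\rm forbmax}_k(m,\mathcal G)=\max_{m'\le m}{\rm forb}_k(m',\mathcal G)$ (taken to be $0$ when no such column sum is possible). For distinct symbols $x,y$, $I_\ell(x,y)$ is the $\ell\times\ell$ matrix with $x$'s on the diagonal and $y$'s elsewhere, and $T_\ell(x,y)$ is the $\ell\times\ell$ matrix with $x$'s strictly below the diagonal and $y$'s on and above the diagonal. $\mathcal T_\ell(r)=\{I_\ell(x,y),\,T_\ell(x,y): x,y\in\{0,\ldots,r-1\},\,x\neq y\}$. $T_\ell(a,b,c)$ is the $\ell\times\ell$ matrix with $a$'s strictly below the diagonal,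 $b$'s on the diagonal and $c$'s strictly above the diagonal. -}

module Defs where

open import Data.Nat using (ℕ; zero; suc; _+_; _≤_; _<_; _≡ᵇ_; _<ᵇ_)
open import Data.Fin using (Fin; zero; suc; toℕ; inject₁)
open import Data.Bool using (if_then_else_)
open import Data.Product using (Σ; Σ-syntax; ∃; ∃-syntax; _×_; _,_)
open import Data.Sum using (_⊎_)
open import Data.List using (List)
open import Data.List.Relation.Unary.All using (All)
open import Relation.Binary.PropositionalEquality using (_≡_; _≢_)
open import Relation.Nullary using (¬_)
open import Function.Definitions using (Injective)

Matrix : ℕ → ℕ → ℕ → Set
Matrix r m n = Fin m → Fin n → Fin r

Simple : ∀ {r m n} → Matrix r m n → Set
Simple {r} {m} {n} A = (j j' : Fin n) → ((i : Fin m) → A i j ≡ A i j') → j ≡ j'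

-- G ≺ A : some submatrix of A (injectively chosen rows and columns)
-- is a row and column permutation of G.
_≺_ : ∀ {r p q m n} → Matrix r p q → Matrix r m n → Set
_≺_ {r} {p} {q} {m} {n} G A =
  Σ (Fin p → Fin m) λ ρ → Σ (Fin q → Fin n) λ κ →
    Injective _≡_ _≡_ ρ × Injective _≡_ _≡_ κ ×
    ((i : Fin p) (j : Fin q) → G i j ≡ A (ρ i) (κ j))

isOne : ∀ {r} → Fin r → ℕ
isOne (suc zero) = 1
isOne _ = 0

ones : ∀ {m r} → (Fin m → Fin r) → ℕ
ones {zero} f = 0
ones {suc m} f = isOne (f zero) + ones (λ i → f (suc i))

AllColSum : ∀ {r m n} → ℕ → Matrix r m n → Set
AllColSum {r} {m} {n} k A = (j : Fin n) → ones (λ i → A i j) ≡ k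

-- "N is an upper bound for forb_k(m, r, P)", where P expresses avoidance
-- of the forbidden family: every m-rowed simple r-matrix with all column
-- sums k satisfying P has at most N columns.  forb_k(m,r,P) ≤ N iff this holds.
ForbBound : (r k m : ℕ) → (∀ {n} → Matrix r m n → Set) → ℕ → Set
ForbBound r k m P N =
  (n : ℕ) (A : Matrix r m n) → Simple A → AllColSum k A → P A → n ≤ N

-- a (0,1)-matrix of arbitrary size (element of a finite family F)
Mat01 : Set
Mat01 = Σ ℕ λ p → Σ ℕ λ q → Matrix 2 p q

AvoidsF : ∀ {m n} → List Mat01 → Matrix 2 m n → Set
AvoidsF F A = All (λ G → ¬ (Data.Product.proj₂ (Data.Product.proj₂ G) ≺ A)) F
  where import Data.Product

ForbmaxBound : ℕ → ℕ → List Mat01 → ℕ → Set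
ForbmaxBound j m F N = (m' : ℕ) → m' ≤ m → ForbBound 2 j m' (AvoidsF F) N

embed : ∀ {p q} → Matrix 2 p q → Matrix 3 p q
embed G i j = inject₁ (G i j)

Iℓ : ∀ {r} ℓ → Fin r → Fin r → Matrix r ℓ ℓ
Iℓ ℓ x y i j = if toℕ i ≡ᵇ toℕ j then x else y

Tℓ : ∀ {r} ℓ → Fin r → Fin r → Matrix r ℓ ℓ
Tℓ ℓ x y i j = if toℕ j <ᵇ toℕ i then x else y

Tℓ3 : ∀ {r} ℓ → Fin r → Fin r → Fin r → Matrix r ℓ ℓ
Tℓ3 ℓ a b c i j =
  if toℕ j <ᵇ toℕ i then a else (if toℕ i ≡ᵇ toℕ j then b else c)

_≐_ : ∀ {r ℓ} → Matrix r ℓ ℓ → Matrix r ℓ ℓ → Set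
M ≐ N = ∀ i j → M i j ≡ N i j

-- M ∈ 𝒯_ℓ(r), for an ℓ×ℓ 3-matrix M, with 𝒯_ℓ(2) viewed as a set of 3-matrices
In𝒯3 : ∀ ℓ → Matrix 3 ℓ ℓ → Set
In𝒯3 ℓ M = Σ (Fin 3) λ x → Σ (Fin 3) λ y → x ≢ y × (M ≐ Iℓ ℓ x y ⊎ M ≐ Tℓ ℓ x y)

In𝒯2 : ∀ ℓ → Matrix 3 ℓ ℓ → Set
In𝒯2 ℓ M = Σ (Fin 2) λ x → Σ (Fin 2) λ y →
  x ≢ y × (M ≐ embed (Iℓ ℓ x y) ⊎ M ≐ embed (Tℓ ℓ x y))

AvoidsFamily : ∀ {m n} → ℕ → List Mat01 → Matrix 3 m n → Set
AvoidsFamily ℓ F A =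
  ((M : Matrix 3 ℓ ℓ) → In𝒯3 ℓ M → ¬ In𝒯2 ℓ M → ¬ (M ≺ A)) ×
  ¬ (Tℓ3 ℓ zero (suc (suc zero)) (suc zero) ≺ A) ×
  All (λ G → ¬ (embed (Data.Product.proj₂ (Data.Product.proj₂ G)) ≺ A)) F
  where import Data.Product

-- sumDown g k d = Σ_{j = max(0,k-d)}^{k} g j
sumDown : (ℕ → ℕ) → ℕ → ℕ → ℕ
sumDown g zero d = g zero
sumDown g (suc k) zero = g (suc k)
sumDown g (suc k) (suc d) = g (suc k) + sumDown g k d

module Submission where

-- Classify the columns of an avoiding simple 3-matrix A by the set of rows
-- holding their 2's (their 2-pattern).  If g+1 columns share a pattern,
-- deleting those rows leaves a simple (0,1)-matrix with g+1 columns, the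
-- same column sums and F avoided, so g+1 ≤ forbmax_k(m, F) (noTwinColumns).
-- Otherwise, if A has many columns, it has many different 2-patterns
-- (twinsOrDistinct).  These yield a staircase: rows r_p, columns c_p whose
-- entries right of the diagonal are constant in each row, differing in being
-- 2 from the diagonal entry (staircase).  Ramsey's theorem for pairs and the
-- pigeonhole principle refine it to a 2ℓ×2ℓ block with constant entries
-- below, on and above the diagonal (shapedBlock), and a case analysis of the
-- colours exhibits a forbidden I_ℓ, T_ℓ or T_ℓ(0,2,1) in it (noShapedBlock).

open import Defs
open import Data.Nat using (ℕ; zero; suc; _+_; _*_; _≤_; _<_; _∸_; _≡ᵇ_; _<ᵇ_; z≤n; s≤s; _≤?_)
open import Data.Nat.Properties
open import Data.Fin using (Fin; zero; suc; toℕ; inject≤; inject₁; opposite; combine; remQuot)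
open import Data.Fin.Properties using (toℕ-inject≤; toℕ<n; opposite-prop; all?; ¬∀⟶∃¬; remQuot-combine)
  renaming (<-cmp to <-cmpᶠ)
open import Data.Bool using (Bool; true; false; not; T)
import Data.Bool.Properties as Bool
open import Data.Product using (Σ; ∃; _×_; _,_; proj₁; proj₂)
open import Data.Sum using (_⊎_; inj₁; inj₂)
open import Data.Empty using (⊥; ⊥-elim)
open import Data.List using (List)
open import Data.List.Relation.Unary.All using (All)
import Data.List.Relation.Unary.All as All
open import Function using (_∘_; id)
open import Function.Definitions using (Injective)
open import Relation.Binary.PropositionalEquality
open import Relation.Binary.Definitions using (tri<; tri≈; tri>)
open import Relation.Nullary using (¬_; Dec; yes; no)
open import Relation.Nullary.Decidable using (⌊_⌋; T?; toWitness; toWitnessFalse)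

≡ᵇ-refl : ∀ n → (n ≡ᵇ n) ≡ true
≡ᵇ-refl zero = refl
≡ᵇ-refl (suc n) = ≡ᵇ-refl n

≢⇒≡ᵇ-false : ∀ {m n} → m ≢ n → (m ≡ᵇ n) ≡ false
≢⇒≡ᵇ-false {zero} {zero} m≢n = ⊥-elim (m≢n refl)
≢⇒≡ᵇ-false {zero} {suc n} _ = refl
≢⇒≡ᵇ-false {suc m} {zero} _ = refl
≢⇒≡ᵇ-false {suc m} {suc n} m≢n = ≢⇒≡ᵇ-false (m≢n ∘ cong suc)

<⇒<ᵇ-true : ∀ {m n} → m < n → (m <ᵇ n) ≡ true
<⇒<ᵇ-true {zero} {suc n} _ = refl
<⇒<ᵇ-true {suc m} {suc n} (s≤s m<n) = <⇒<ᵇ-true m<n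

≥⇒<ᵇ-false : ∀ {m n} → n ≤ m → (m <ᵇ n) ≡ false
≥⇒<ᵇ-false {m} {zero} _ = refl
≥⇒<ᵇ-false {suc m} {suc n} (s≤s n≤m) = ≥⇒<ᵇ-false n≤m

Increasing : ∀ {a b} → (Fin a → Fin b) → Set
Increasing e = ∀ {i j} → toℕ i < toℕ j → toℕ (e i) < toℕ (e j)

increasing-∘ : ∀ {a b c} {e : Fin b → Fin c} {f : Fin a → Fin b} →
  Increasing e → Increasing f → Increasing (e ∘ f)
increasing-∘ e↑ f↑ = e↑ ∘ f↑

separating⇒injective : ∀ {a} {B : Set} {f : Fin a → B} →
  (∀ {i j} → toℕ i < toℕ j → f i ≢ f j) → Injective _≡_ _≡_ f
separating⇒injective separates {i} {j} fi≡fj with <-cmpᶠ i j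
... | tri< i<j _ _ = ⊥-elim (separates i<j fi≡fj)
... | tri≈ _ i≡j _ = i≡j
... | tri> _ _ j<i = ⊥-elim (separates j<i (sym fi≡fj))

increasing⇒injective : ∀ {a b} {e : Fin a → Fin b} → Increasing e → Injective _≡_ _≡_ e
increasing⇒injective e↑ = separating⇒injective (λ i<j eq → <-irrefl (cong toℕ eq) (e↑ i<j))

inject≤-increasing : ∀ {a b} (a≤b : a ≤ b) → Increasing (λ (i : Fin a) → inject≤ i a≤b)
inject≤-increasing a≤b {i} {j} i<j rewrite toℕ-inject≤ i a≤b | toℕ-inject≤ j a≤b = i<j

indicator : Bool → ℕ
indicator true = 1
indicator false = 0

count : ∀ {m} → (Fin m → Bool) → ℕ
count {zero} p = 0
count {suc m} p = indicator (p zero) + count (p ∘ suc)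

selectStep : ∀ {c m} (b : Bool) → (Fin c → Fin m) → Fin (indicator b + c) → Fin (suc m)
selectStep true f zero = zero
selectStep true f (suc i) = suc (f i)
selectStep false f i = suc (f i)

select : ∀ {m} (p : Fin m → Bool) → Fin (count p) → Fin m
select {suc m} p = selectStep (p zero) (select (p ∘ suc))

select-satisfies : ∀ {m} (p : Fin m → Bool) i → T (p (select p i))
select-satisfies {suc m} p i with p zero in eq
select-satisfies {suc m} p zero | true = subst T (sym eq) _
select-satisfies {suc m} p (suc i) | true = select-satisfies (p ∘ suc) i
select-satisfies {suc m} p i | false = select-satisfies (p ∘ suc) i

select-increasing : ∀ {m} (p : Fin m → Bool) → Increasing (select p)
select-increasing {suc m} p {i} {j} i<j with p zero
select-increasing {suc m} p {zero} {suc j} i<j | true = s≤s z≤n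
select-increasing {suc m} p {suc i} {suc j} (s≤s i<j) | true = s≤s (select-increasing (p ∘ suc) i<j)
select-increasing {suc m} p i<j | false = s≤s (select-increasing (p ∘ suc) i<j)

select-complete : ∀ {m} (p : Fin m → Bool) i → T (p i) → ∃ λ i' → select p i' ≡ i
select-complete {suc m} p zero pi with p zero
... | true = zero , refl
select-complete {suc m} p (suc i) pi with select-complete (p ∘ suc) i pi | p zero
... | i' , eq | true = suc i' , cong suc eq
... | i' , eq | false = i' , cong suc eq

count-complement : ∀ {m} (p : Fin m → Bool) → count p + count (not ∘ p) ≡ m
count-complement {zero} p = refl
count-complement {suc m} p with p zero
... | true = cong suc (count-complement (p ∘ suc))
... | false = trans (+-suc (count (p ∘ suc)) _) (cong suc (count-complement (p ∘ suc)))

count-≤ : ∀ {m} (p : Fin m → Bool) → count p ≤ m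
count-≤ {m} p = subst (count p ≤_) (count-complement p) (m≤m+n _ _)

-- Pigeonhole principle: a large colour class, enumerated increasingly

record ColourClass {N k} (f : Fin N → Fin k) (a : ℕ) : Set where
  constructor colourClass
  field
    colour : Fin k
    pick : Fin a → Fin N
    pick-increasing : Increasing pick
    pick-colour : ∀ i → f (pick i) ≡ colour

-- Colour 0 against the others: the pigeonhole principle peels off one
-- colour at a time.
isZero : ∀ {c} → Fin (suc c) → Bool
isZero zero = true
isZero (suc _) = false

isZero-sound : ∀ {c} (x : Fin (suc c)) → T (isZero x) → x ≡ zero
isZero-sound zero _ = refl

lowerColour : ∀ {c} → Fin (suc (suc c)) → Fin (suc c)
lowerColour zero = zero
lowerColour (suc x) = x

lowerColour-sound : ∀ {c} (x : Fin (suc (suc c))) → T (not (isZero x)) → x ≡ suc (lowerColour x)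
lowerColour-sound (suc x) _ = refl

onlyColour : (x : Fin 1) → x ≡ zero
onlyColour zero = refl

+-cancel-≤-smaller : ∀ a x b y → a + x ≤ b + y → b ≤ a → x ≤ y
+-cancel-≤-smaller a x b y a+x≤b+y b≤a = +-cancelˡ-≤ a x y (≤-trans a+x≤b+y (+-monoˡ-≤ y b≤a))

pigeonhole : ∀ c {N} (f : Fin N → Fin (suc c)) a → suc c * a ≤ N → ColourClass f a
pigeonhole zero {N} f a ca≤N = colourClass zero (λ i → inject≤ i a≤N) (inject≤-increasing a≤N) (λ _ → onlyColour _)
  where
    a≤N : a ≤ N
    a≤N = subst (_≤ N) (+-identityʳ a) ca≤N
pigeonhole (suc c) {N} f a ca≤N = byZeros (a ≤? count zeros)
  where
    zeros others : Fin N → Bool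
    zeros = isZero ∘ f
    others = not ∘ zeros
    byZeros : Dec (a ≤ count zeros) → ColourClass f a
    byZeros (yes a≤zeros) =
      colourClass zero (select zeros ∘ (λ i → inject≤ i a≤zeros))
        (increasing-∘ (select-increasing zeros) (inject≤-increasing a≤zeros))
        (λ i → isZero-sound _ (select-satisfies zeros _))
    byZeros (no a≰zeros) =
      colourClass (suc colour) (select others ∘ pick)
        (increasing-∘ (select-increasing others) pick-increasing)
        (λ i → trans (lowerColour-sound _ (select-satisfies others (pick i))) (cong suc (pick-colour i)))
      where
        enough : suc c * a ≤ count others
        enough = +-cancel-≤-smaller a (suc c * a) (count zeros) (count others)
                   (subst (a + suc c * a ≤_) (sym (count-complement zeros)) ca≤N)
                   (<⇒≤ (≰⇒> a≰zeros))
        open ColourClass (pigeonhole c (lowerColour ∘ f ∘ select others) a enough)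

record Homogeneous3 {N} (f g h : Fin N → Fin 3) (a : ℕ) : Set where
  field
    pick : Fin a → Fin N
    pick-increasing : Increasing pick
    x y z : Fin 3
    f-const : ∀ i → f (pick i) ≡ x
    g-const : ∀ i → g (pick i) ≡ y
    h-const : ∀ i → h (pick i) ≡ z

-- Pigeonhole applied to the combined colouring with 27 colours.
pigeonhole³ : ∀ {N} (f g h : Fin N → Fin 3) a → 27 * a ≤ N → Homogeneous3 f g h a
pigeonhole³ f g h a 27a≤N = record
  { pick = pick ; pick-increasing = pick-increasing
  ; x = proj₁ (decode colour) ; y = proj₁ (proj₂ (decode colour)) ; z = proj₂ (proj₂ (decode colour))
  ; f-const = λ i → cong proj₁ (decode-pick i)
  ; g-const = λ i → cong (proj₁ ∘ proj₂) (decode-pick i)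
  ; h-const = λ i → cong (proj₂ ∘ proj₂) (decode-pick i) }
  where
    encode : Fin 3 × Fin 3 × Fin 3 → Fin 27
    encode (u , v , w) = combine u (combine v w)
    decodeTail : Fin 3 × Fin 9 → Fin 3 × Fin 3 × Fin 3
    decodeTail (u , vw) = u , remQuot {3} 3 vw
    decode : Fin 27 → Fin 3 × Fin 3 × Fin 3
    decode = decodeTail ∘ remQuot {3} 9
    decode-encode : ∀ t → decode (encode t) ≡ t
    decode-encode (u , v , w) =
      trans (cong decodeTail (remQuot-combine u (combine v w))) (cong (u ,_) (remQuot-combine v w))
    open ColourClass (pigeonhole 26 (λ i → encode (f i , g i , h i)) a 27a≤N)
    decode-pick : ∀ i → (f (pick i) , g (pick i) , h (pick i)) ≡ decode colour
    decode-pick i = trans (sym (decode-encode _)) (cong decode (pick-colour i))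

-- The first step of Ramsey's theorem for 3-coloured pairs

record EndHomogeneous {N} (χ : Fin N → Fin N → Fin 3) (s : ℕ) : Set where
  field
    point : Fin s → Fin N
    point-increasing : Increasing point
    colour : Fin s → Fin 3
    homogeneous : ∀ {i j} → toℕ i < toℕ j → χ (point i) (point j) ≡ colour i

ramseyBound : ℕ → ℕ
ramseyBound zero = 0
ramseyBound (suc s) = suc (3 * ramseyBound s)

-- Keep the first point, pass to the largest colour class of its pairs with
-- the later points, and recurse inside that class.
endHomogeneous : ∀ s {N} → ramseyBound s ≤ N → (χ : Fin N → Fin N → Fin 3) → EndHomogeneous χ s
endHomogeneous zero _ χ = record
  { point = λ () ; point-increasing = λ {} ; colour = λ () ; homogeneous = λ {} }
endHomogeneous (suc s) {suc N} (s≤s bound) χ = record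
  { point = point ; point-increasing = increasing ; colour = colour ; homogeneous = homogeneous }
  where
    firstPairs : ColourClass (χ zero ∘ suc) (ramseyBound s)
    firstPairs = pigeonhole 2 (χ zero ∘ suc) (ramseyBound s) bound
    module C = ColourClass firstPairs
    module R = EndHomogeneous (endHomogeneous s ≤-refl (λ i j → χ (suc (C.pick i)) (suc (C.pick j))))
    point : Fin (suc s) → Fin (suc N)
    point zero = zero
    point (suc i) = suc (C.pick (R.point i))
    colour : Fin (suc s) → Fin 3
    colour zero = C.colour
    colour (suc i) = R.colour i
    increasing : Increasing point
    increasing {zero} {suc j} _ = s≤s z≤n
    increasing {suc i} {suc j} (s≤s i<j) = s≤s (C.pick-increasing (R.point-increasing i<j))
    homogeneous : ∀ {i j} → toℕ i < toℕ j → χ (point i) (point j) ≡ colour i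
    homogeneous {zero} {suc j} _ = C.pick-colour (R.point j)
    homogeneous {suc i} {suc j} (s≤s i<j) = R.homogeneous i<j

pattern f0 = zero
pattern f1 = suc zero
pattern f2 = suc (suc zero)

is2 : Fin 3 → Bool
is2 f2 = true
is2 _ = false

module _ {m n : ℕ} (A : Matrix 3 m n) where

  SameTwos : Fin n → Fin n → Set
  SameTwos c c' = ∀ i → is2 (A i c) ≡ is2 (A i c')

  sameTwos? : ∀ c c' → Dec (SameTwos c c')
  sameTwos? c c' = all? (λ i → is2 (A i c) Bool.≟ is2 (A i c'))

  differingRow : ∀ {c c'} → ¬ SameTwos c c' → ∃ λ i → is2 (A i c) ≢ is2 (A i c')
  differingRow {c} {c'} = ¬∀⟶∃¬ m _ (λ i → is2 (A i c) Bool.≟ is2 (A i c'))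

  DistinctTwos : ∀ {K} → (Fin K → Fin n) → Set
  DistinctTwos E = ∀ {x y} → x ≢ y → ¬ SameTwos (E x) (E y)

  record TwinColumns (g : ℕ) : Set where
    field
      column : Fin (suc g) → Fin n
      column-injective : Injective _≡_ _≡_ column
      column-sameTwos : ∀ j → SameTwos (column zero) (column j)

  -- Among more than K·g distinct columns, either g+1 share a 2-pattern or
  -- K have pairwise different 2-patterns: either the class of the first
  -- column is large, or we recurse on the columns outside that class.
  twinsOrDistinct : ∀ g K {N} (D : Fin N → Fin n) → Injective _≡_ _≡_ D → K * g < N →
    TwinColumns g ⊎ Σ (Fin K → Fin N) (λ ι → DistinctTwos (D ∘ ι))
  twinsOrDistinct g zero D _ _ = inj₂ ((λ ()) , λ { {()} })
  twinsOrDistinct g (suc K) {suc N} D D-injective bound = byClassSize (suc g ≤? count twin)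
    where
      twin : Fin (suc N) → Bool
      twin x = ⌊ sameTwos? (D zero) (D x) ⌋
      others : Fin (suc N) → Bool
      others = not ∘ twin
      byClassSize : Dec (suc g ≤ count twin) → TwinColumns g ⊎ Σ (Fin (suc K) → Fin (suc N)) (λ ι → DistinctTwos (D ∘ ι))
      byClassSize (yes large) = inj₁ (record
        { column = D ∘ pick
        ; column-injective = increasing⇒injective pick-increasing ∘ D-injective
        ; column-sameTwos = λ j i → trans (sym (twin-pick zero i)) (twin-pick j i) })
        where
          pick : Fin (suc g) → Fin (suc N)
          pick = select twin ∘ (λ j → inject≤ j large)
          pick-increasing : Increasing pick
          pick-increasing = increasing-∘ (select-increasing twin) (inject≤-increasing large)
          twin-pick : ∀ j → SameTwos (D zero) (D (pick j))
          twin-pick j = toWitness (select-satisfies twin (inject≤ j large))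
      byClassSize (no small) with twinsOrDistinct g K (D ∘ select others)
             (increasing⇒injective (select-increasing others) ∘ D-injective) enough
        where
          enough : K * g < count others
          enough = +-cancel-≤-smaller g (suc (K * g)) (count twin) (count others)
                     (subst₂ _≤_ (sym (+-suc g (K * g))) (sym (count-complement twin)) bound)
                     (≤-pred (≰⇒> small))
      ... | inj₁ twins = inj₁ twins
      ... | inj₂ (ι , distinct) = inj₂ (ι' , distinct')
        where
          notTwin : ∀ x → ¬ SameTwos (D zero) (D (select others (ι x)))
          notTwin x = toWitnessFalse (select-satisfies others (ι x))
          ι' : Fin (suc K) → Fin (suc N)
          ι' zero = zero
          ι' (suc x) = select others (ι x)
          distinct' : DistinctTwos (D ∘ ι')
          distinct' {zero} {zero} 0≢0 = ⊥-elim (0≢0 refl)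
          distinct' {zero} {suc y} _ = notTwin y
          distinct' {suc x} {zero} _ same = notTwin x (λ i → sym (same i))
          distinct' {suc x} {suc y} x≢y = distinct (x≢y ∘ cong suc)

-- Twin columns contradict the bound on forbmax_k(m, F)

is2-sound : ∀ x → T (is2 x) → x ≡ f2
is2-sound f2 _ = refl

¬T⇒T-not : ∀ b → ¬ T b → T (not b)
¬T⇒T-not true ¬t = ¬t _
¬T⇒T-not false _ = _

T-not-not : ∀ b → T (not (not b)) → T b
T-not-not true _ = _

-- The (0,1)-entry standing for a 3-entry that is not 2.
to01 : Fin 3 → Fin 2
to01 f0 = zero
to01 f1 = suc zero
to01 f2 = zero

to01-embeds : ∀ x → T (not (is2 x)) → inject₁ (to01 x) ≡ x
to01-embeds f0 _ = refl
to01-embeds f1 _ = refl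
to01-embeds f2 ()

isOne-to01 : ∀ x → isOne (to01 x) ≡ isOne x
isOne-to01 f0 = refl
isOne-to01 f1 = refl
isOne-to01 f2 = refl

ones-cong : ∀ {m r r'} (v : Fin m → Fin r) (w : Fin m → Fin r') →
  (∀ i → isOne (v i) ≡ isOne (w i)) → ones v ≡ ones w
ones-cong {zero} v w _ = refl
ones-cong {suc m} v w same = cong₂ _+_ (same zero) (ones-cong (v ∘ suc) (w ∘ suc) (same ∘ suc))

ones-select : ∀ {m r} (p : Fin m → Bool) (v : Fin m → Fin r) →
  (∀ i → T (not (p i)) → isOne (v i) ≡ 0) → ones (v ∘ select p) ≡ ones v
ones-select {zero} p v _ = refl
ones-select {suc m} p v deleted with p zero in eq
... | true = cong (isOne (v zero) +_) (ones-select (p ∘ suc) (v ∘ suc) (deleted ∘ suc))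
... | false = trans (ones-select (p ∘ suc) (v ∘ suc) (deleted ∘ suc))
                    (cong (_+ ones (v ∘ suc)) (sym (deleted zero (subst (T ∘ not) (sym eq) _))))

module TwinMatrix {m n : ℕ} (A : Matrix 3 m n) {g : ℕ} (twins : TwinColumns A g) where
  open TwinColumns twins

  keep : Fin m → Bool
  keep i = not (is2 (A i (column zero)))

  twinMatrix : Matrix 2 (count keep) (suc g)
  twinMatrix i j = to01 (A (select keep i) (column j))

  embeds : ∀ i j → inject₁ (twinMatrix i j) ≡ A (select keep i) (column j)
  embeds i j = to01-embeds _ (subst (T ∘ not) (column-sameTwos j _) (select-satisfies keep i))

  deletedRow : ∀ {i} j → T (is2 (A i (column zero))) → A i (column j) ≡ f2
  deletedRow {i} j two = is2-sound _ (subst T (column-sameTwos j i) two)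

  simple : Simple A → Simple twinMatrix
  simple A-simple j j' sameColumn = column-injective (A-simple (column j) (column j') sameEntries)
    where
      sameEntries : ∀ i → A i (column j) ≡ A i (column j')
      sameEntries i with T? (is2 (A i (column zero)))
      ... | yes two = trans (deletedRow j two) (sym (deletedRow j' two))
      ... | no ¬two with select-complete keep i (¬T⇒T-not _ ¬two)
      ...   | i' , refl = trans (sym (embeds i' j)) (trans (cong inject₁ (sameColumn i')) (embeds i' j'))

  colSum : ∀ {k} → AllColSum k A → AllColSum k twinMatrix
  colSum A-colSum j = begin
    ones (λ i → twinMatrix i j)                 ≡⟨ ones-cong (λ i → twinMatrix i j) _ (λ i → isOne-to01 _) ⟩
    ones (λ i → A (select keep i) (column j))   ≡⟨ ones-select keep (λ i → A i (column j)) deletedNoOne ⟩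
    ones (λ i → A i (column j))                 ≡⟨ A-colSum (column j) ⟩
    _                                           ∎
    where
      open ≡-Reasoning
      deletedNoOne : ∀ i → T (not (keep i)) → isOne (A i (column j)) ≡ 0
      deletedNoOne i deleted = cong isOne (deletedRow j (T-not-not _ deleted))

  avoids : ∀ {F : List Mat01} → All (λ G → ¬ (embed (proj₂ (proj₂ G)) ≺ A)) F → AvoidsF F twinMatrix
  avoids = All.map lift
    where
      lift : ∀ {G : Mat01} → ¬ (embed (proj₂ (proj₂ G)) ≺ A) → ¬ (proj₂ (proj₂ G) ≺ twinMatrix)
      lift G⊀A (ρ , κ , ρ-inj , κ-inj , entries) =
        G⊀A ( select keep ∘ ρ , column ∘ κ
            , ρ-inj ∘ increasing⇒injective (select-increasing keep) , κ-inj ∘ column-injective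
            , λ i j → trans (cong inject₁ (entries i j)) (embeds (ρ i) (κ j)))

noTwinColumns : ∀ {m n k g} {F : List Mat01} (A : Matrix 3 m n) → Simple A → AllColSum k A →
  All (λ G → ¬ (embed (proj₂ (proj₂ G)) ≺ A)) F → ForbmaxBound k m F g → ¬ TwinColumns A g
noTwinColumns {g = g} A A-simple A-colSum A-avoids forbmax twins =
  1+n≰n (forbmax (count keep) (count-≤ keep) (suc g) twinMatrix (simple A-simple) (colSum A-colSum) (avoids A-avoids))
  where
    open TwinMatrix A twins

-- Many different 2-patterns yield a staircase

staircaseBound : ℕ → ℕ
staircaseBound zero = 0
staircaseBound (suc t) = 2 + 3 * staircaseBound t

module _ {m n : ℕ} (A : Matrix 3 m n) where

  record Staircase {N} (D : Fin N → Fin n) (t : ℕ) : Set where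
    field
      row : Fin t → Fin m
      index : Fin t → Fin N
      right : Fin t → Fin 3
      right-const : ∀ {p q} → toℕ p < toℕ q → A (row p) (D (index q)) ≡ right p
      diagonal-differs : ∀ p → is2 (A (row p) (D (index p))) ≢ is2 (right p)

  -- Two of the columns differ in a row r; a third of all columns agree in
  -- row r on a colour a, and one of the two columns does not agree with a
  -- in being 2.  It starts the staircase, continued inside the colour class.
  staircase : ∀ t {N} → staircaseBound t ≤ N → (D : Fin N → Fin n) →
    DistinctTwos A D → Staircase D t
  staircase zero _ D _ = record
    { row = λ () ; index = λ () ; right = λ () ; right-const = λ {} ; diagonal-differs = λ () }
  staircase (suc t) {suc (suc N)} (s≤s (s≤s bound)) D distinct = record
    { row = row ; index = index ; right = right ; right-const = right-const ; diagonal-differs = differs }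
    where
      differ : ∃ λ i → is2 (A i (D zero)) ≢ is2 (A i (D (suc zero)))
      differ = differingRow A (distinct {zero} {suc zero} (λ ()))
      r : Fin m
      r = proj₁ differ
      class : ColourClass (λ x → A r (D x)) (staircaseBound t)
      class = pigeonhole 2 (λ x → A r (D x)) (staircaseBound t) (≤-trans bound (m≤n+m N 2))
      module C = ColourClass class
      first : Σ (Fin (2 + N)) λ c → is2 (A r (D c)) ≢ is2 C.colour
      first with is2 (A r (D zero)) Bool.≟ is2 C.colour
      ... | yes same = suc zero , λ h → proj₂ differ (trans same (sym h))
      ... | no differs = zero , differs
      module S = Staircase (staircase t ≤-refl (D ∘ C.pick)
                              (λ x≢y → distinct (x≢y ∘ increasing⇒injective C.pick-increasing)))
      row : Fin (suc t) → Fin m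
      row zero = r
      row (suc p) = S.row p
      index : Fin (suc t) → Fin (2 + N)
      index zero = proj₁ first
      index (suc p) = C.pick (S.index p)
      right : Fin (suc t) → Fin 3
      right zero = C.colour
      right (suc p) = S.right p
      right-const : ∀ {p q} → toℕ p < toℕ q → A (row p) (D (index q)) ≡ right p
      right-const {zero} {suc q} _ = C.pick-colour (S.index q)
      right-const {suc p} {suc q} (s≤s p<q) = S.right-const p<q
      differs : ∀ p → is2 (A (row p) (D (index p))) ≢ is2 (right p)
      differs zero = proj₂ first
      differs (suc p) = S.diagonal-differs p

record Shaped {ℓ} (M : Matrix 3 ℓ ℓ) (a b c : Fin 3) : Set where
  field
    below : ∀ {i j} → toℕ j < toℕ i → M i j ≡ a
    diagonal : ∀ i → M i i ≡ b
    above : ∀ {i j} → toℕ i < toℕ j → M i j ≡ c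

I-shaped : ∀ {ℓ} (x y : Fin 3) → Shaped (Iℓ ℓ x y) y x y
I-shaped {ℓ} x y = record { below = below ; diagonal = diagonal ; above = above }
  where
    below : ∀ {i j} → toℕ j < toℕ i → Iℓ ℓ x y i j ≡ y
    below j<i rewrite ≢⇒≡ᵇ-false (>⇒≢ j<i) = refl
    diagonal : ∀ i → Iℓ ℓ x y i i ≡ x
    diagonal i rewrite ≡ᵇ-refl (toℕ i) = refl
    above : ∀ {i j} → toℕ i < toℕ j → Iℓ ℓ x y i j ≡ y
    above i<j rewrite ≢⇒≡ᵇ-false (<⇒≢ i<j) = refl

T-shaped : ∀ {ℓ} (x y : Fin 3) → Shaped (Tℓ ℓ x y) x y y
T-shaped {ℓ} x y = record { below = below ; diagonal = diagonal ; above = above }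
  where
    below : ∀ {i j} → toℕ j < toℕ i → Tℓ ℓ x y i j ≡ x
    below j<i rewrite <⇒<ᵇ-true j<i = refl
    diagonal : ∀ i → Tℓ ℓ x y i i ≡ y
    diagonal i rewrite ≥⇒<ᵇ-false (≤-refl {toℕ i}) = refl
    above : ∀ {i j} → toℕ i < toℕ j → Tℓ ℓ x y i j ≡ y
    above i<j rewrite ≥⇒<ᵇ-false (<⇒≤ i<j) = refl

T3-shaped : ∀ {ℓ} (a b c : Fin 3) → Shaped (Tℓ3 ℓ a b c) a b c
T3-shaped {ℓ} a b c = record { below = below ; diagonal = diagonal ; above = above }
  where
    below : ∀ {i j} → toℕ j < toℕ i → Tℓ3 ℓ a b c i j ≡ a
    below j<i rewrite <⇒<ᵇ-true j<i = refl
    diagonal : ∀ i → Tℓ3 ℓ a b c i i ≡ b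
    diagonal i rewrite ≥⇒<ᵇ-false (≤-refl {toℕ i}) | ≡ᵇ-refl (toℕ i) = refl
    above : ∀ {i j} → toℕ i < toℕ j → Tℓ3 ℓ a b c i j ≡ c
    above i<j rewrite ≥⇒<ᵇ-false (<⇒≤ i<j) | ≢⇒≡ᵇ-false (<⇒≢ i<j) = refl

shaped-unique : ∀ {ℓ} {M M' : Matrix 3 ℓ ℓ} {a b c} → Shaped M a b c → Shaped M' a b c → M ≐ M'
shaped-unique S S' i j with <-cmpᶠ i j
... | tri< i<j _ _ = trans (Shaped.above S i<j) (sym (Shaped.above S' i<j))
... | tri≈ _ refl _ = trans (Shaped.diagonal S i) (sym (Shaped.diagonal S' i))
... | tri> _ _ j<i = trans (Shaped.below S j<i) (sym (Shaped.below S' j<i))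

submatrix : ∀ {r m n ℓ} → Matrix r m n → (Fin ℓ → Fin m) → (Fin ℓ → Fin n) → Matrix r ℓ ℓ
submatrix A ρ κ i j = A (ρ i) (κ j)

-- A shaped submatrix with a ≠ b uses distinct rows and distinct columns,
-- so every matrix of the same shape is contained in A.
shaped-≺ : ∀ {m n ℓ} {A : Matrix 3 m n} {M : Matrix 3 ℓ ℓ} {a b c} (ρ : Fin ℓ → Fin m) (κ : Fin ℓ → Fin n) →
  Shaped (submatrix A ρ κ) a b c → a ≢ b → Shaped M a b c → M ≺ A
shaped-≺ {A = A} ρ κ S a≢b S-M = ρ , κ , ρ-injective , κ-injective , shaped-unique S-M S
  where
    open Shaped S
    ρ-injective : Injective _≡_ _≡_ ρ
    ρ-injective = separating⇒injective λ {i} i<j ρi≡ρj →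
      a≢b (trans (sym (below i<j)) (trans (cong (λ r → A r (κ i)) (sym ρi≡ρj)) (diagonal i)))
    κ-injective : Injective _≡_ _≡_ κ
    κ-injective = separating⇒injective λ {_} {j} i<j κi≡κj →
      a≢b (trans (sym (below i<j)) (trans (cong (A (ρ j)) κi≡κj) (diagonal j)))

twice : ℕ → ℕ
twice zero = zero
twice (suc ℓ) = suc (suc (twice ℓ))

even odd : ∀ {ℓ} → Fin ℓ → Fin (twice ℓ)
even zero = zero
even (suc i) = suc (suc (even i))
odd zero = suc zero
odd (suc i) = suc (suc (odd i))

toℕ-even : ∀ {ℓ} (i : Fin ℓ) → toℕ (even i) ≡ toℕ i + toℕ i
toℕ-even zero = refl
toℕ-even (suc i) = cong suc (trans (cong suc (toℕ-even i)) (sym (+-suc (toℕ i) (toℕ i))))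

toℕ-odd : ∀ {ℓ} (i : Fin ℓ) → toℕ (odd i) ≡ suc (toℕ i + toℕ i)
toℕ-odd zero = refl
toℕ-odd (suc i) = cong (λ k → suc (suc k)) (trans (toℕ-odd i) (sym (+-suc (toℕ i) (toℕ i))))

even-increasing : ∀ {ℓ} → Increasing (even {ℓ})
even-increasing {i = i} {j} i<j rewrite toℕ-even i | toℕ-even j = +-mono-< i<j i<j

even<odd : ∀ {ℓ} {i j : Fin ℓ} → toℕ i ≤ toℕ j → toℕ (even i) < toℕ (odd j)
even<odd {i = i} {j} i≤j rewrite toℕ-even i | toℕ-odd j = s≤s (+-mono-≤ i≤j i≤j)

odd<even : ∀ {ℓ} {i j : Fin ℓ} → toℕ i < toℕ j → toℕ (odd i) < toℕ (even j)
odd<even {i = i} {j} i<j rewrite toℕ-odd i | toℕ-even j =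
  subst (_≤ toℕ j + toℕ j) (cong suc (+-suc (toℕ i) (toℕ i))) (+-mono-≤ i<j i<j)

opposite-reverses : ∀ {ℓ} {i j : Fin ℓ} → toℕ i < toℕ j → toℕ (opposite j) < toℕ (opposite i)
opposite-reverses {i = i} {j} i<j rewrite opposite-prop i | opposite-prop j = ∸-monoʳ-< (s≤s i<j) (toℕ<n j)

module _ {ℓ : ℕ} {M : Matrix 3 ℓ ℓ} {a b c : Fin 3} (S : Shaped M a b c) where
  open Shaped S

  reversed : Shaped (submatrix M opposite opposite) c b a
  reversed = record
    { below = above ∘ opposite-reverses ; diagonal = diagonal ∘ opposite ; above = below ∘ opposite-reverses }

module _ {ℓ : ℕ} {M : Matrix 3 (twice ℓ) (twice ℓ)} {a b c : Fin 3} (S : Shaped M a b c) where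
  open Shaped S

  evens : Shaped (submatrix M even even) a b c
  evens = record
    { below = below ∘ even-increasing ; diagonal = diagonal ∘ even ; above = above ∘ even-increasing }

  -- Odd rows against even columns: the diagonal moves below the diagonal.
  oddsEvens : Shaped (submatrix M odd even) a a c
  oddsEvens = record
    { below = λ j<i → below (even<odd (<⇒≤ j<i)) ; diagonal = λ i → below (even<odd ≤-refl) ; above = above ∘ odd<even }

-- A long staircase contains a shaped block

record ShapedBlock {m n} (A : Matrix 3 m n) (ℓ : ℕ) : Set where
  field
    rows : Fin ℓ → Fin m
    cols : Fin ℓ → Fin n
    a b c : Fin 3
    shaped : Shaped (submatrix A rows cols) a b c
    separated : is2 b ≢ is2 c

-- Ramsey's step makes the entries below the diagonal depend only on the
-- column; the pigeonhole principle then makes the colours below, on and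
-- to the right of the diagonal constant.
shapedBlock : ∀ {m n N} {A : Matrix 3 m n} {D : Fin N → Fin n} L →
  Staircase A D (ramseyBound (27 * suc L)) → ShapedBlock A (suc L)
shapedBlock {n = n} {A = A} {D} L stairs = record
  { rows = row ∘ σ ; cols = D ∘ index ∘ σ ; a = H.x ; b = H.z ; c = H.y
  ; shaped = record { below = below ; diagonal = H.h-const ; above = above }
  ; separated = λ eq → diagonal-differs (σ zero)
                         (trans (cong is2 (H.h-const zero)) (trans eq (cong is2 (sym (H.g-const zero))))) }
  where
    open Staircase stairs
    column : Fin (ramseyBound (27 * suc L)) → Fin n
    column = D ∘ index
    module E = EndHomogeneous (endHomogeneous (27 * suc L) ≤-refl (λ p q → A (row q) (column p)))
    module H = Homogeneous3 (pigeonhole³ E.colour (right ∘ E.point)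
                               (λ p → A (row (E.point p)) (column (E.point p))) (suc L) ≤-refl)
    σ : Fin (suc L) → Fin (ramseyBound (27 * suc L))
    σ = E.point ∘ H.pick
    σ-increasing : Increasing σ
    σ-increasing = increasing-∘ E.point-increasing H.pick-increasing
    below : ∀ {i j} → toℕ j < toℕ i → A (row (σ i)) (column (σ j)) ≡ H.x
    below {j = j} j<i = trans (E.homogeneous (H.pick-increasing j<i)) (H.f-const j)
    above : ∀ {i j} → toℕ i < toℕ j → A (row (σ i)) (column (σ j)) ≡ H.y
    above {i} i<j = trans (right-const (σ-increasing i<j)) (H.g-const i)

-- Shaped blocks are forbidden

embed-no-2 : (z : Fin 2) → inject₁ z ≢ f2
embed-no-2 zero ()
embed-no-2 (suc zero) ()

has2⇒∉𝒯₂ : ∀ {ℓ} (M : Matrix 3 ℓ ℓ) i j → M i j ≡ f2 → ¬ In𝒯2 ℓ M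
has2⇒∉𝒯₂ M i j Mij≡2 (_ , _ , _ , inj₁ M≐I) = embed-no-2 _ (trans (sym (M≐I i j)) Mij≡2)
has2⇒∉𝒯₂ M i j Mij≡2 (_ , _ , _ , inj₂ M≐T) = embed-no-2 _ (trans (sym (M≐T i j)) Mij≡2)

module _ {m n ℓ : ℕ} {F : List Mat01} (A : Matrix 3 m n) (avoid : AvoidsFamily ℓ F A)
         (ρ : Fin ℓ → Fin m) (κ : Fin ℓ → Fin n) where

  I-forbidden : ∀ {x y} i j → x ≢ y → Iℓ ℓ x y i j ≡ f2 → ¬ Shaped (submatrix A ρ κ) y x y
  I-forbidden {x} {y} i j x≢y two S =
    proj₁ avoid (Iℓ ℓ x y) (x , y , x≢y , inj₁ (λ _ _ → refl)) (has2⇒∉𝒯₂ _ i j two)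
      (shaped-≺ {A = A} ρ κ S (x≢y ∘ sym) (I-shaped x y))

  T-forbidden : ∀ {x y} i j → x ≢ y → Tℓ ℓ x y i j ≡ f2 → ¬ Shaped (submatrix A ρ κ) x y y
  T-forbidden {x} {y} i j x≢y two S =
    proj₁ avoid (Tℓ ℓ x y) (x , y , x≢y , inj₂ (λ _ _ → refl)) (has2⇒∉𝒯₂ _ i j two)
      (shaped-≺ {A = A} ρ κ S x≢y (T-shaped x y))

  T021-forbidden : ¬ Shaped (submatrix A ρ κ) f0 f2 f1
  T021-forbidden S = proj₁ (proj₂ avoid) (shaped-≺ {A = A} ρ κ S (λ ()) (T3-shaped f0 f2 f1))

separatedShape-forbidden : ∀ {m n} ℓ {F : List Mat01} (A : Matrix 3 m n) → AvoidsFamily (suc ℓ) F A →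
  (ρ : Fin (twice (suc ℓ)) → Fin m) (κ : Fin (twice (suc ℓ)) → Fin n) →
  ∀ a b c → Shaped (submatrix A ρ κ) a b c → is2 b ≢ is2 c → ⊥
-- the diagonal holds the 2's
separatedShape-forbidden ℓ A avoid ρ κ f0 f2 f0 S _ = I-forbidden A avoid _ _ zero zero (λ ()) refl (evens S)
separatedShape-forbidden ℓ A avoid ρ κ f1 f2 f1 S _ = I-forbidden A avoid _ _ zero zero (λ ()) refl (evens S)
separatedShape-forbidden ℓ A avoid ρ κ f0 f2 f1 S _ = T021-forbidden A avoid _ _ (evens S)
separatedShape-forbidden ℓ A avoid ρ κ f1 f2 f0 S _ = T021-forbidden A avoid _ _ (reversed (evens S))
separatedShape-forbidden ℓ A avoid ρ κ f2 f2 f0 S _ = T-forbidden A avoid _ _ zero zero (λ ()) refl (reversed (oddsEvens S))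
separatedShape-forbidden ℓ A avoid ρ κ f2 f2 f1 S _ = T-forbidden A avoid _ _ zero zero (λ ()) refl (reversed (oddsEvens S))
-- the region above the diagonal holds the 2's; for ℓ = 1 a single entry 2 is forbidden
separatedShape-forbidden zero A avoid ρ κ a b f2 S _ =
  I-forbidden A avoid (λ _ → ρ zero) (λ _ → κ (suc zero)) {f2} {f0} zero zero (λ ()) refl
    (record { below = λ { {zero} {zero} () } ; diagonal = λ { zero → Shaped.above S (s≤s z≤n) }
            ; above = λ { {zero} {zero} () } })
separatedShape-forbidden (suc ℓ) A avoid ρ κ f0 b f2 S _ = T-forbidden A avoid _ _ (suc zero) zero (λ ()) refl (reversed (oddsEvens S))
separatedShape-forbidden (suc ℓ) A avoid ρ κ f1 b f2 S _ = T-forbidden A avoid _ _ (suc zero) zero (λ ()) refl (reversed (oddsEvens S))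
separatedShape-forbidden (suc ℓ) A avoid ρ κ f2 f0 f2 S _ = I-forbidden A avoid _ _ (suc zero) zero (λ ()) refl (evens S)
separatedShape-forbidden (suc ℓ) A avoid ρ κ f2 f1 f2 S _ = I-forbidden A avoid _ _ (suc zero) zero (λ ()) refl (evens S)
-- otherwise the diagonal and upper colours agree in being 2
separatedShape-forbidden ℓ A avoid ρ κ a f0 f0 S separated = separated refl
separatedShape-forbidden ℓ A avoid ρ κ a f0 f1 S separated = separated refl
separatedShape-forbidden ℓ A avoid ρ κ a f1 f0 S separated = separated refl
separatedShape-forbidden ℓ A avoid ρ κ a f1 f1 S separated = separated refl
separatedShape-forbidden ℓ A avoid ρ κ a f2 f2 S separated = separated refl

noShapedBlock : ∀ {m n ℓ} {F : List Mat01} {A : Matrix 3 m n} →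
  AvoidsFamily (suc ℓ) F A → ¬ ShapedBlock A (twice (suc ℓ))
noShapedBlock {ℓ = ℓ} {A = A} avoid block = separatedShape-forbidden ℓ A avoid rows cols a b c shaped separated
  where open ShapedBlock block

-- Columns with pairwise different 2-patterns, this many of them, give a
-- staircase long enough to contain a shaped 2ℓ×2ℓ block.
patternBound : ℕ → ℕ
patternBound ℓ = staircaseBound (ramseyBound (27 * twice ℓ))

-- If forbmax_k(m, F) ≤ g then forb_k(m, 3, family) ≤ patternBound ℓ · g:
-- otherwise either g+1 columns share a 2-pattern, or there are so many
-- 2-patterns that a forbidden shaped block appears.
columnBound : ∀ ℓ {F : List Mat01} {m k g} → ForbmaxBound k m F g →
  ForbBound 3 k m (AvoidsFamily (suc ℓ) F) (patternBound (suc ℓ) * g)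
columnBound ℓ {g = g} forbmax n A A-simple A-colSum avoid with n ≤? patternBound (suc ℓ) * g
... | yes bounded = bounded
... | no tooMany with twinsOrDistinct A g (patternBound (suc ℓ)) id id (≰⇒> tooMany)
...   | inj₁ twins = ⊥-elim (noTwinColumns A A-simple A-colSum (proj₂ (proj₂ avoid)) forbmax twins)
...   | inj₂ (ι , distinct) = ⊥-elim (noShapedBlock avoid (shapedBlock _ (staircase A _ ≤-refl ι distinct)))

sumDown-zero : ∀ g k → sumDown g k 0 ≡ g k
sumDown-zero g zero = refl
sumDown-zero g (suc k) = refl

-- The bound holds already with d = 0, since deleting rows of 2's does not
-- change column sums.
mainTheorem11 : (ℓ : ℕ) → 1 ≤ ℓ → (F : List Mat01) →
    Σ ℕ λ d → Σ ℕ λ C → Σ ℕ λ M →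
    (m : ℕ) → M ≤ m → (k : ℕ) → (g : ℕ → ℕ) →
    ((j : ℕ) → k ∸ d ≤ j → j ≤ k → ForbmaxBound j m F (g j)) →
    ForbBound 3 k m (AvoidsFamily ℓ F) (C * sumDown g k d)
mainTheorem11 zero () F
mainTheorem11 (suc ℓ) _ F = 0 , patternBound (suc ℓ) , 0 , λ m _ k g forbmax →
  subst (λ N → ForbBound 3 k m (AvoidsFamily (suc ℓ) F) (patternBound (suc ℓ) * N))
        (sym (sumDown-zero g k))
        (columnBound ℓ (forbmax k ≤-refl ≤-refl))
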